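{- Let \(G\) be a graph with \(\Delta(G)\leq 4\). If \(T\) is an internal triangle of \(G\) and \(T'\) is any triangle of \(G\) with \(T\cap T'=\{x\}\), then the open neighborhood \(N(x)\) induces a \(4\)-cycle.
   Context: All graphs are finite and simple; a clique is a maximal complete subgraph. A triangle \(T\) (three pairwise adjacent vertices) is internal if it is a clique and every edge of \(T\) is contained in a clique different from \(T\). -}

module Defs where

open import Data.Nat using (ℕ; _≤_)
open import Data.Fin using (Fin; zero; suc)
open import Data.Bool using (Bool; true; false)
open import Data.List using (List; length; filterᵇ; allFin)
open import Data.Product using (Σ; ∃; _×_; _,_)
open import Data.Sum using (_⊎_)
open import Relation.Nullary using (¬_)
open import Relation.Binary.PropositionalEquality using (_≡_; _≢_)
open import Function.Bundles using (_⇔_)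
open import Function.Definitions using (Injective)

record Graph : Set where
  field
    n      : ℕ
    adj    : Fin n → Fin n → Bool
    sym    : ∀ u v → adj u v ≡ adj v u
    irrefl : ∀ v → adj v v ≡ false

module _ (G : Graph) where
  open Graph G

  Adj : Fin n → Fin n → Set
  Adj u v = adj u v ≡ true

  degree : Fin n → ℕ
  degree v = length (filterᵇ (adj v) (allFin n))

  MaxDegreeAtMost : ℕ → Set
  MaxDegreeAtMost k = ∀ v → degree v ≤ k

  Complete : (Fin n → Set) → Set
  Complete S = ∀ u v → S u → S v → u ≢ v → Adj u v

  -- clique = maximal complete subgraph (maximal w.r.t. inclusion:
  -- no vertex outside S is adjacent to every vertex of S)
  IsClique : (Fin n → Set) → Set
  IsClique S = Complete S × (∀ w → ¬ S w → ¬ (∀ u → S u → Adj w u))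

  -- triangle: three pairwise adjacent vertices (hence pairwise distinct)
  IsTriangle : Fin n → Fin n → Fin n → Set
  IsTriangle a b c = Adj a b × Adj b c × Adj a c

  triple : Fin n → Fin n → Fin n → Fin n → Set
  triple a b c w = (w ≡ a) ⊎ (w ≡ b) ⊎ (w ≡ c)

  DifferentSets : (Fin n → Set) → (Fin n → Set) → Set
  DifferentSets S T = ¬ (∀ w → S w ⇔ T w)

  EdgeInOtherClique : (Fin n → Set) → Fin n → Fin n → Set₁
  EdgeInOtherClique T u v =
    ∃ λ (S : Fin n → Set) → IsClique S × S u × S v × DifferentSets S T

  IsInternalTriangle : Fin n → Fin n → Fin n → Set₁
  IsInternalTriangle a b c =
    IsTriangle a b c × IsClique (triple a b c)
    × EdgeInOtherClique (triple a b c) a b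
    × EdgeInOtherClique (triple a b c) b c
    × EdgeInOtherClique (triple a b c) a c

  N : Fin n → Fin n → Set
  N x w = Adj x w

C4adj : Fin 4 → Fin 4 → Bool
C4adj zero (suc zero) = true
C4adj zero (suc (suc (suc zero))) = true
C4adj (suc zero) zero = true
C4adj (suc zero) (suc (suc zero)) = true
C4adj (suc (suc zero)) (suc zero) = true
C4adj (suc (suc zero)) (suc (suc (suc zero))) = true
C4adj (suc (suc (suc zero))) (suc (suc zero)) = true
C4adj (suc (suc (suc zero))) zero = true
C4adj _ _ = false

-- the subgraph of G induced by S is isomorphic to C4: there is a bijection
-- φ : Fin 4 → S (injective, with image exactly S) preserving and
-- reflecting adjacency
InducesC4 : (G : Graph) → (Fin (Graph.n G) → Set) → Set
InducesC4 G S =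
  ∃ λ (φ : Fin 4 → Fin (Graph.n G)) →
    Injective _≡_ _≡_ φ
    × (∀ w → S w ⇔ (∃ λ i → φ i ≡ w))
    × (∀ i j → Graph.adj G (φ i) (φ j) ≡ C4adj i j)

-- N(x) contains the other two vertices p, q of T and the two vertices y, z
-- of T', and Δ ≤ 4 makes these all of N(x). The clique through xp other
-- than T lies in N[x] = {x, p, q, y, z}; were p adjacent to neither y nor z
-- it would lie inside T and so equal T. Hence p, and likewise q, is
-- adjacent to y or z, while maximality of T forbids y or z to see both p
-- and q. So N(x) is the 4-cycle p q z y (or p q y z).
module Submission where

open import Defs
open import Data.Bool using (true; T?)
open import Data.Bool.Properties using (¬-not; T-≡) renaming (_≟_ to _≟ᵇ_)
open import Data.Empty using (⊥; ⊥-elim)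
open import Data.Fin using (Fin; zero; suc; _≟_)
open import Data.List using (List; []; _∷_; length; lookup; filterᵇ; allFin)
open import Data.List.Properties using (length-removeAt′)
open import Data.List.Membership.Propositional using (_∈_)
open import Data.List.Membership.Propositional.Properties
  using (∈-lookup; ∈-filter⁺; ∈-allFin)
open import Data.List.Relation.Binary.Permutation.Propositional using (_↭_; prep; swap; ↭-refl; ↭-sym)
open import Data.List.Relation.Binary.Permutation.Propositional.Properties using (∈-resp-↭)
open import Data.List.Relation.Unary.All as All using (All; []; _∷_)
open import Data.List.Relation.Unary.All.Properties using (¬Any⇒All¬)
open import Data.List.Relation.Unary.Any using (Any; here; there; index; any?; _─_)
open import Data.List.Relation.Unary.Any.Properties using (lookup-index)
open import Data.List.Relation.Unary.Unique.Propositional using (Unique)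
open import Data.List.Relation.Unary.AllPairs using ([]; _∷_)
open import Data.Nat using (suc; _≤_; z≤n; s≤s)
open import Data.Nat.Properties using (≤-trans; ≤-reflexive; 1+n≰n)
open import Data.Product using (∃; _×_; _,_; proj₁; proj₂)
open import Data.Sum using (_⊎_; inj₁; inj₂)
open import Function using (_∘_)
open import Function.Bundles using (_⇔_; mk⇔; Equivalence)
open import Function.Definitions using (Injective)
open import Level using (0ℓ)
open import Relation.Nullary using (¬_; yes; no)
open import Relation.Unary using (Pred; _⊆_; _≐_)
open import Relation.Unary.Properties using (≐-refl; ≐-trans)
open import Relation.Binary.PropositionalEquality using (_≡_; _≢_; refl; sym; trans)

module _ {A : Set} where

  ∈-─⁺ : ∀ {u v : A} {xs} (v∈xs : v ∈ xs) → u ∈ xs → u ≢ v → u ∈ (xs ─ v∈xs)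
  ∈-─⁺ (here refl) (here refl) u≢v = ⊥-elim (u≢v refl)
  ∈-─⁺ (here refl) (there u∈xs) _  = u∈xs
  ∈-─⁺ (there _)   (here refl)  _  = here refl
  ∈-─⁺ (there v∈xs) (there u∈xs) u≢v = there (∈-─⁺ v∈xs u∈xs u≢v)

  Unique-⊆⇒length≤ : ∀ {ys xs : List A} → Unique ys → All (_∈ xs) ys → length ys ≤ length xs
  Unique-⊆⇒length≤ [] [] = z≤n
  Unique-⊆⇒length≤ {y ∷ ys} {xs} (y≢ys ∷ ys!) (y∈xs ∷ ys⊆xs) =
    ≤-trans (s≤s (Unique-⊆⇒length≤ ys! ys⊆xs─y))
            (≤-reflexive (sym (length-removeAt′ xs (index y∈xs))))
    where
    ys⊆xs─y : All (_∈ (xs ─ y∈xs)) ys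
    ys⊆xs─y = All.zipWith (λ (y≢u , u∈xs) → ∈-─⁺ y∈xs u∈xs (y≢u ∘ sym)) (y≢ys , ys⊆xs)

module _ {A B C : Set} where

  swap₁₂ : A ⊎ B ⊎ C → B ⊎ A ⊎ C
  swap₁₂ (inj₁ a)        = inj₂ (inj₁ a)
  swap₁₂ (inj₂ (inj₁ b)) = inj₁ b
  swap₁₂ (inj₂ (inj₂ c)) = inj₂ (inj₂ c)

  swap₂₃ : A ⊎ B ⊎ C → A ⊎ C ⊎ B
  swap₂₃ (inj₁ a)        = inj₁ a
  swap₂₃ (inj₂ (inj₁ b)) = inj₂ (inj₂ b)
  swap₂₃ (inj₂ (inj₂ c)) = inj₂ (inj₁ c)

module _ (G : Graph) where
  open Graph G renaming (sym to adj-sym)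
  open import Data.List.Membership.DecPropositional (_≟_ {n}) using (_∈?_)

  private
    V : Set
    V = Fin n

  Adj-sym : ∀ {u v} → Adj G u v → Adj G v u
  Adj-sym {u} {v} u~v = trans (adj-sym v u) u~v

  Adj⇒≢ : ∀ {u v} → Adj G u v → u ≢ v
  Adj⇒≢ {u} u~u refl with trans (sym u~u) (irrefl u)
  ... | ()

  triple-swap₁₂ : ∀ {a b c} → triple G a b c ≐ triple G b a c
  triple-swap₁₂ = swap₁₂ , swap₁₂

  triple-swap₂₃ : ∀ {a b c} → triple G a b c ≐ triple G a c b
  triple-swap₂₃ = swap₂₃ , swap₂₃

  EdgeInOtherClique-sym : ∀ {T u v} → EdgeInOtherClique G T u v → EdgeInOtherClique G T v u
  EdgeInOtherClique-sym (S , S-clique , Su , Sv , S≠T) = S , S-clique , Sv , Su , S≠T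

  distinct-neighbours≤degree : ∀ {x L} → Unique L → All (Adj G x) L → length L ≤ degree G x
  distinct-neighbours≤degree {x} L! x~L =
    Unique-⊆⇒length≤ L! (All.map (λ {v} x~v → ∈-filter⁺ (T? ∘ adj x) (∈-allFin v) (Equivalence.from T-≡ x~v))
                                 x~L)

  distinct-neighbours-exhaust : ∀ {x L} → MaxDegreeAtMost G (length L) →
    Unique L → All (Adj G x) L → N G x ≐ (_∈ L)
  distinct-neighbours-exhaust {x} {L} Δ≤|L| L! x~L = N⊆L , All.lookup x~L
    where
    N⊆L : N G x ⊆ (_∈ L)
    N⊆L {w} x~w with w ∈? L
    ... | yes w∈L = w∈L
    ... | no  w∉L = ⊥-elim (1+n≰n (≤-trans |w∷L|≤deg (Δ≤|L| x)))
      where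
      |w∷L|≤deg : suc (length L) ≤ degree G x
      |w∷L|≤deg = distinct-neighbours≤degree (¬Any⇒All¬ L w∉L ∷ L!) (x~w ∷ x~L)

  cycle⇒InducesC4 : ∀ {S : Pred V 0ℓ} {v₀ v₁ v₂ v₃} →
    Adj G v₀ v₁ → Adj G v₁ v₂ → Adj G v₂ v₃ → Adj G v₃ v₀ →
    ¬ Adj G v₀ v₂ → ¬ Adj G v₁ v₃ → v₀ ≢ v₂ → v₁ ≢ v₃ →
    S ≐ (_∈ v₀ ∷ v₁ ∷ v₂ ∷ v₃ ∷ []) → InducesC4 G S
  cycle⇒InducesC4 {S} {v₀} {v₁} {v₂} {v₃} v₀~v₁ v₁~v₂ v₂~v₃ v₃~v₀ v₀≁v₂ v₁≁v₃ v₀≢v₂ v₁≢v₃ (S⊆ , S⊇) =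
    v , v-injective , S⇔image , v-adjacency
    where
    v : Fin 4 → V
    v = lookup (v₀ ∷ v₁ ∷ v₂ ∷ v₃ ∷ [])

    S⇔image : ∀ w → S w ⇔ ∃ λ i → v i ≡ w
    S⇔image w = mk⇔ (λ Sw → index (S⊆ Sw) , sym (lookup-index (S⊆ Sw)))
                    (λ { (i , refl) → S⊇ (∈-lookup i) })

    v-adjacency : ∀ i j → adj (v i) (v j) ≡ C4adj i j
    v-adjacency zero zero                                       = irrefl v₀
    v-adjacency zero (suc zero)                                 = v₀~v₁
    v-adjacency zero (suc (suc zero))                           = ¬-not v₀≁v₂
    v-adjacency zero (suc (suc (suc zero)))                     = Adj-sym v₃~v₀
    v-adjacency (suc zero) zero                                 = Adj-sym v₀~v₁
    v-adjacency (suc zero) (suc zero)                           = irrefl v₁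
    v-adjacency (suc zero) (suc (suc zero))                     = v₁~v₂
    v-adjacency (suc zero) (suc (suc (suc zero)))               = ¬-not v₁≁v₃
    v-adjacency (suc (suc zero)) zero                           = ¬-not (v₀≁v₂ ∘ Adj-sym)
    v-adjacency (suc (suc zero)) (suc zero)                     = Adj-sym v₁~v₂
    v-adjacency (suc (suc zero)) (suc (suc zero))               = irrefl v₂
    v-adjacency (suc (suc zero)) (suc (suc (suc zero)))         = v₂~v₃
    v-adjacency (suc (suc (suc zero))) zero                     = v₃~v₀
    v-adjacency (suc (suc (suc zero))) (suc zero)               = ¬-not (v₁≁v₃ ∘ Adj-sym)
    v-adjacency (suc (suc (suc zero))) (suc (suc zero))         = Adj-sym v₂~v₃
    v-adjacency (suc (suc (suc zero))) (suc (suc (suc zero)))   = irrefl v₃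

    v-injective : Injective _≡_ _≡_ v
    v-injective {zero} {zero} _                                 = refl
    v-injective {zero} {suc zero} e                             = ⊥-elim (Adj⇒≢ v₀~v₁ e)
    v-injective {zero} {suc (suc zero)} e                       = ⊥-elim (v₀≢v₂ e)
    v-injective {zero} {suc (suc (suc zero))} e                 = ⊥-elim (Adj⇒≢ v₃~v₀ (sym e))
    v-injective {suc zero} {zero} e                             = ⊥-elim (Adj⇒≢ v₀~v₁ (sym e))
    v-injective {suc zero} {suc zero} _                         = refl
    v-injective {suc zero} {suc (suc zero)} e                   = ⊥-elim (Adj⇒≢ v₁~v₂ e)
    v-injective {suc zero} {suc (suc (suc zero))} e             = ⊥-elim (v₁≢v₃ e)
    v-injective {suc (suc zero)} {zero} e                       = ⊥-elim (v₀≢v₂ (sym e))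
    v-injective {suc (suc zero)} {suc zero} e                   = ⊥-elim (Adj⇒≢ v₁~v₂ (sym e))
    v-injective {suc (suc zero)} {suc (suc zero)} _             = refl
    v-injective {suc (suc zero)} {suc (suc (suc zero))} e       = ⊥-elim (Adj⇒≢ v₂~v₃ e)
    v-injective {suc (suc (suc zero))} {zero} e                 = ⊥-elim (Adj⇒≢ v₃~v₀ e)
    v-injective {suc (suc (suc zero))} {suc zero} e             = ⊥-elim (v₁≢v₃ (sym e))
    v-injective {suc (suc (suc zero))} {suc (suc zero)} e       = ⊥-elim (Adj⇒≢ v₂~v₃ (sym e))
    v-injective {suc (suc (suc zero))} {suc (suc (suc zero))} _ = refl

  clique⊆triangle⇒¬different : ∀ {S T x p q} → IsClique G S → S x → S p → S ⊆ triple G x p q →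
    Adj G q x → Adj G q p → T ≐ triple G x p q → ¬ DifferentSets G S T
  clique⊆triangle⇒¬different {S} {x = x} {p} {q} (_ , S-maximal) Sx Sp S⊆xpq q~x q~p (T⊆ , T⊇) S≠T =
    S-maximal q q∉S q~S
    where
    q∉S : ¬ S q
    q∉S Sq = S≠T λ w → mk⇔ (T⊇ ∘ S⊆xpq) (xpq⊆S ∘ T⊆)
      where
      xpq⊆S : triple G x p q ⊆ S
      xpq⊆S (inj₁ refl)        = Sx
      xpq⊆S (inj₂ (inj₁ refl)) = Sp
      xpq⊆S (inj₂ (inj₂ refl)) = Sq

    q~S : ∀ u → S u → Adj G q u
    q~S u Su with S⊆xpq Su
    ... | inj₁ refl        = q~x
    ... | inj₂ (inj₁ refl) = q~p
    ... | inj₂ (inj₂ refl) = ⊥-elim (q∉S Su)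

  clique-triangle-has-no-outside-common-neighbour : ∀ {T x p q w} → IsClique G T → T ⊆ triple G x p q →
    ¬ T w → Adj G w x → Adj G w p → Adj G w q → ⊥
  clique-triangle-has-no-outside-common-neighbour (_ , T-maximal) T⊆xpq w∉T w~x w~p w~q =
    T-maximal _ w∉T λ u Tu → w~xpq (T⊆xpq Tu)
    where
    w~xpq : triple G _ _ _ ⊆ Adj G _
    w~xpq (inj₁ refl)        = w~x
    w~xpq (inj₂ (inj₁ refl)) = w~p
    w~xpq (inj₂ (inj₂ refl)) = w~q

  other-clique-through-edge-leaves-triangle : ∀ {T x p q O} → T ≐ triple G x p q →
    Adj G q x → Adj G q p → N G x ⊆ (_∈ p ∷ q ∷ O) → EdgeInOtherClique G T x p → Any (Adj G p) O
  other-clique-through-edge-leaves-triangle {x = x} {p} {q} {O} T≐xpq q~x q~p N⊆pqO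
    (S , S-clique@(S-complete , _) , Sx , Sp , S≠T) with any? (λ v → adj p v ≟ᵇ true) O
  ... | yes p~O = p~O
  ... | no  p≁O = ⊥-elim (clique⊆triangle⇒¬different S-clique Sx Sp S⊆xpq q~x q~p T≐xpq S≠T)
    where
    S⊆xpq : S ⊆ triple G x p q
    S⊆xpq {w} Sw with w ≟ x | w ≟ p
    ... | yes w≡x | _       = inj₁ w≡x
    ... | no _    | yes w≡p = inj₂ (inj₁ w≡p)
    ... | no w≢x  | no w≢p  with N⊆pqO (S-complete x w Sx Sw (w≢x ∘ sym))
    ...   | here w≡p          = ⊥-elim (w≢p w≡p)
    ...   | there (here w≡q)  = inj₂ (inj₂ w≡q)
    ...   | there (there w∈O) =
      ⊥-elim (All.lookup (¬Any⇒All¬ O p≁O) w∈O (S-complete p w Sp Sw (w≢p ∘ sym)))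

  internal-triangle-vertex-has-C4-neighbourhood : ∀ {T x p q y z} → MaxDegreeAtMost G 4 →
    T ≐ triple G x p q → IsClique G T → Adj G x p → Adj G x q → Adj G p q →
    EdgeInOtherClique G T x p → EdgeInOtherClique G T x q →
    IsTriangle G x y z → ¬ T y → ¬ T z → InducesC4 G (N G x)
  internal-triangle-vertex-has-C4-neighbourhood {T} {x} {p} {q} {y} {z} Δ≤4 T≐xpq@(T⊆ , T⊇) T-clique
    x~p x~q p~q xp-other xq-other (x~y , y~z , x~z) y∉T z∉T =
    conclude (other-clique-through-edge-leaves-triangle T≐xpq (Adj-sym x~q) (Adj-sym p~q) N⊆pqyz xp-other)
             (other-clique-through-edge-leaves-triangle T≐xqp (Adj-sym x~p) p~q N⊆qpyz xq-other)
    where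
    T≐xqp : T ≐ triple G x q p
    T≐xqp = ≐-trans T≐xpq triple-swap₂₃

    outside-T : ∀ {w} → ¬ T w → p ≢ w × q ≢ w
    outside-T w∉T = (λ { refl → w∉T (T⊇ (inj₂ (inj₁ refl))) }) , (λ { refl → w∉T (T⊇ (inj₂ (inj₂ refl))) })

    pqyz! : Unique (p ∷ q ∷ y ∷ z ∷ [])
    pqyz! = (Adj⇒≢ p~q ∷ proj₁ (outside-T y∉T) ∷ proj₁ (outside-T z∉T) ∷ [])
          ∷ (proj₂ (outside-T y∉T) ∷ proj₂ (outside-T z∉T) ∷ [])
          ∷ (Adj⇒≢ y~z ∷ [])
          ∷ [] ∷ []

    N≐pqyz : N G x ≐ (_∈ p ∷ q ∷ y ∷ z ∷ [])
    N≐pqyz = distinct-neighbours-exhaust Δ≤4 pqyz! (x~p ∷ x~q ∷ x~y ∷ x~z ∷ [])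

    N⊆pqyz : N G x ⊆ (_∈ p ∷ q ∷ y ∷ z ∷ [])
    N⊆pqyz = proj₁ N≐pqyz

    N⊆qpyz : N G x ⊆ (_∈ q ∷ p ∷ y ∷ z ∷ [])
    N⊆qpyz = ∈-resp-↭ (swap p q ↭-refl) ∘ N⊆pqyz

    N≐pqzy : N G x ≐ (_∈ p ∷ q ∷ z ∷ y ∷ [])
    N≐pqzy = ∈-resp-↭ yz↭zy ∘ N⊆pqyz , proj₂ N≐pqyz ∘ ∈-resp-↭ (↭-sym yz↭zy)
      where
      yz↭zy : p ∷ q ∷ y ∷ z ∷ [] ↭ p ∷ q ∷ z ∷ y ∷ []
      yz↭zy = prep p (prep q (swap y z ↭-refl))

    not-both : ∀ {w} → ¬ T w → Adj G x w → Adj G p w → ¬ Adj G q w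
    not-both w∉T x~w p~w q~w = clique-triangle-has-no-outside-common-neighbour T-clique T⊆ w∉T
      (Adj-sym x~w) (Adj-sym p~w) (Adj-sym q~w)

    conclude : Any (Adj G p) (y ∷ z ∷ []) → Any (Adj G q) (y ∷ z ∷ []) → InducesC4 G (N G x)
    conclude (here p~y) (here q~y) = ⊥-elim (not-both y∉T x~y p~y q~y)
    conclude (there (here p~z)) (there (here q~z)) = ⊥-elim (not-both z∉T x~z p~z q~z)
    conclude (here p~y) (there (here q~z)) =
      cycle⇒InducesC4 p~q q~z (Adj-sym y~z) (Adj-sym p~y)
        (λ p~z → not-both z∉T x~z p~z q~z) (not-both y∉T x~y p~y)
        (proj₁ (outside-T z∉T)) (proj₂ (outside-T y∉T)) N≐pqzy
    conclude (there (here p~z)) (here q~y) =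
      cycle⇒InducesC4 p~q q~y y~z (Adj-sym p~z)
        (λ p~y → not-both y∉T x~y p~y q~y) (not-both z∉T x~z p~z)
        (proj₁ (outside-T y∉T)) (proj₂ (outside-T z∉T)) N≐pqyz
    conclude (there (there ())) _
    conclude _ (there (there ()))

mainTheorem8 : (G : Graph) → MaxDegreeAtMost G 4 →
    (a b c : Fin (Graph.n G)) → IsInternalTriangle G a b c →
    (x y z : Fin (Graph.n G)) → IsTriangle G x y z →
    triple G a b c x → ¬ triple G a b c y → ¬ triple G a b c z →
    InducesC4 G (N G x)
mainTheorem8 G Δ≤4 a b c ((a~b , b~c , a~c) , T-clique , ab-other , bc-other , ac-other)
  x y z xyz x∈T y∉T z∉T = C4-by-position x∈T
  where
  C4-at : ∀ {p q} → triple G a b c ≐ triple G x p q → Adj G x p → Adj G x q → Adj G p q →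
    EdgeInOtherClique G (triple G a b c) x p → EdgeInOtherClique G (triple G a b c) x q →
    InducesC4 G (N G x)
  C4-at T≐xpq x~p x~q p~q xp-other xq-other = internal-triangle-vertex-has-C4-neighbourhood G
    Δ≤4 T≐xpq T-clique x~p x~q p~q xp-other xq-other xyz y∉T z∉T

  C4-by-position : triple G a b c x → InducesC4 G (N G x)
  C4-by-position (inj₁ refl) = C4-at ≐-refl a~b a~c b~c ab-other ac-other
  C4-by-position (inj₂ (inj₁ refl)) = C4-at (triple-swap₁₂ G) (Adj-sym G a~b) b~c a~c
    (EdgeInOtherClique-sym G ab-other) bc-other
  C4-by-position (inj₂ (inj₂ refl)) = C4-at (≐-trans (triple-swap₂₃ G) (triple-swap₁₂ G))
    (Adj-sym G a~c) (Adj-sym G b~c) a~b (EdgeInOtherClique-sym G ac-other) (EdgeInOtherClique-sym G bc-other)
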